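{- Let $G=(V,E)$ be an undirected graph, $k\in\mathbb{N}$, and let $\{x_v\}_{v\in V},\{d_{u,v}\}_{u,v\in V},\{f_{u,v}\}_{u,v\in V}$ be an optimal solution of the LP below. Fix $\epsilon\in(0,1/2)$, let $V'=\{v\in V: x_v<\epsilon\}$, and for $u,v\in V'$ let $d'_{u,v}$ be the minimum, over simple paths $u=u_0,u_1,\dots,u_p=v$ in the induced subgraph $G|_{V'}$, of $x_{u_0}+\dots+x_{u_p}$. For $w\in V'$ let $B(w)=\{v\in V': d'_{w,v}\le 2\epsilon\}$. Then for every $w\in V'$, $|B(w)|\le\frac{k}{1-2\epsilon}$.
   Context: The LP (spreading-metric relaxation of $k$-Vertex Separator) has variables $x_v$ ($v\in V$), $d_{u,v}$ and $f_{u,v}$ ($(u,v)\in V\times V$), and is: minimize $\sum_{v\in V}x_v$ subject to $d_{u,u}=x_u$ for all $u\in V$; $d_{u,w}\le d_{u,v}+x_w$ for all $(u,v)\in V\times V$ and $(v,w)\in E$; $f_{u,v}\ge 1-d_{u,v}$ and $f_{u,v}\ge 0$ for all $(u,v)\in V\times V$; $\sum_{u\in V}f_{v,u}\le k$ for all $v\in V$; $x_v\ge 0$ for all $v\in V$. (The first two constraint families say that $d_{u,v}$ is at most the minimum over simple $u$–$v$ paths of the sum of $x$ over all vertices of the path, including both endpoints.) -}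

module Defs where

open import Data.Nat using (ℕ; zero; suc)
open import Data.Fin using (Fin; zero; suc)
open import Data.Fin.Subset using (Subset; _∈_; ∣_∣)
open import Data.Integer using (+_)
open import Data.Rational using (ℚ; 0ℚ; 1ℚ; _+_; _-_; _*_; _≤_; _<_; _/_)
open import Data.List using (List; []; _∷_; foldr)
open import Data.List.Relation.Unary.All using (All)
open import Data.List.Relation.Unary.Unique.Propositional using (Unique)
open import Data.List.Relation.Unary.Linked using (Linked)
open import Data.Product using (Σ; _×_; ∃)
open import Data.Maybe using (Maybe; just; nothing)
open import Function.Bundles using (_⇔_)
open import Relation.Binary.PropositionalEquality using (_≡_)

record Graph (n : ℕ) : Set₁ where
  field
    Adj : Fin n → Fin n → Set
    sym : ∀ {u v} → Adj u v → Adj v u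
open Graph public

ℕ→ℚ : ℕ → ℚ
ℕ→ℚ m = + m / 1

sumℚ : ∀ {n} → (Fin n → ℚ) → ℚ
sumℚ {zero}  g = 0ℚ
sumℚ {suc n} g = g zero + sumℚ (λ i → g (suc i))

-- Feasibility for the spreading-metric LP relaxation of k-Vertex Separator
record Feasible {n : ℕ} (G : Graph n) (k : ℕ)
                (x : Fin n → ℚ) (d f : Fin n → Fin n → ℚ) : Set where
  field
    diag   : ∀ u → d u u ≡ x u
    metric : ∀ u v w → Adj G v w → d u w ≤ d u v + x w
    f-lb   : ∀ u v → 1ℚ - d u v ≤ f u v
    f-nn   : ∀ u v → 0ℚ ≤ f u v
    budget : ∀ v → sumℚ (λ u → f v u) ≤ ℕ→ℚ k
    x-nn   : ∀ v → 0ℚ ≤ x v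

record Optimal {n : ℕ} (G : Graph n) (k : ℕ)
               (x : Fin n → ℚ) (d f : Fin n → Fin n → ℚ) : Set where
  field
    feasible : Feasible G k x d f
    minimal  : ∀ (x′ : Fin n → ℚ) (d′ f′ : Fin n → Fin n → ℚ) →
               Feasible G k x′ d′ f′ → sumℚ x ≤ sumℚ x′

data Walk {n : ℕ} (G : Graph n) : Fin n → Fin n → Set where
  single : ∀ u → Walk G u u
  step   : ∀ {u v w} → Adj G u v → Walk G v w → Walk G u w

verts : ∀ {n} {G : Graph n} {u v} → Walk G u v → List (Fin n)
verts (single u) = u ∷ []
verts (step {u = u} _ p) = u ∷ verts p

weight : ∀ {n} {G : Graph n} {u v} → (Fin n → ℚ) → Walk G u v → ℚ
weight x p = foldr (λ a r → x a + r) 0ℚ (verts p)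

V′ : ∀ {n} → (Fin n → ℚ) → ℚ → Fin n → Set
V′ x ε v = x v < ε

-- simple path in the induced subgraph G|_{V′}: all vertices distinct and in V′
SimpleIn : ∀ {n} {G : Graph n} {u v} → (Fin n → Set) → Walk G u v → Set
SimpleIn P p = Unique (verts p) × All P (verts p)

IsDist′ : ∀ {n} (G : Graph n) (x : Fin n → ℚ) (ε : ℚ) (u v : Fin n) (r : ℚ) → Set
IsDist′ G x ε u v r =
  (Σ (Walk G u v) λ p → SimpleIn (V′ x ε) p × weight x p ≡ r) ×
  (∀ (p : Walk G u v) → SimpleIn (V′ x ε) p → r ≤ weight x p)

InBall : ∀ {n} (G : Graph n) (x : Fin n → ℚ) (ε : ℚ) (w v : Fin n) → Set
InBall G x ε w v = V′ x ε v × ∃ λ r → IsDist′ G x ε w v r × r ≤ ℕ→ℚ 2 * ε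

-- The metric constraints, applied along a w–v
-- path starting from d_{w,w} = x_w, bound d_{w,v} by the weight of the path;
-- so for v ∈ B(w) we get d_{w,v} ≤ 2ε and hence f_{w,v} ≥ 1 − 2ε.  Summing
-- over B(w) and using the budget Σ_u f_{w,u} ≤ k gives |B(w)| (1 − 2ε) ≤ k.
module Submission where

open import Defs
open import Data.Nat using (ℕ; zero; suc)
open import Data.Fin using (Fin; zero; suc)
open import Data.Fin.Subset using (Subset; _∈_; ∣_∣; inside; outside)
open import Data.Rational using (ℚ; 0ℚ; 1ℚ; ½; _-_; _*_; _≤_; _<_; _+_)
open import Data.Rational.Properties
import Data.Nat.Properties as ℕ
import Data.Nat.Coprimality as Coprime
import Data.Integer.Properties as ℤ
open import Data.Vec using (_∷_; []; here; there)
open import Data.Product using (_,_)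
open import Function.Base using (_∘_)
open import Function.Bundles using (_⇔_; Equivalence)
open import Relation.Binary.PropositionalEquality using (_≡_; refl; trans; cong; subst) renaming (sym to ≡-sym)
open Relation.Binary.PropositionalEquality.≡-Reasoning

ℕ→ℚ-suc : ∀ m → ℕ→ℚ (suc m) ≡ 1ℚ + ℕ→ℚ m
ℕ→ℚ-suc m
  rewrite normalize-coprime (Coprime.sym (Coprime.1-coprimeTo m))
        | ℕ.*-identityʳ m | ℤ.+◃n≡+n m = refl

ℕ→ℚ-suc-*-distrib : ∀ m t → ℕ→ℚ (suc m) * t ≡ t + ℕ→ℚ m * t
ℕ→ℚ-suc-*-distrib m t = begin
  ℕ→ℚ (suc m) * t      ≡⟨ cong (_* t) (ℕ→ℚ-suc m) ⟩
  (1ℚ + ℕ→ℚ m) * t     ≡⟨ *-distribʳ-+ t 1ℚ (ℕ→ℚ m) ⟩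
  1ℚ * t + ℕ→ℚ m * t   ≡⟨ cong (_+ ℕ→ℚ m * t) (*-identityˡ t) ⟩
  t + ℕ→ℚ m * t        ∎

∣B∣*t≤sumℚ : ∀ {n} (g : Fin n → ℚ) (B : Subset n) (t : ℚ) →
             (∀ v → 0ℚ ≤ g v) → (∀ v → v ∈ B → t ≤ g v) →
             ℕ→ℚ ∣ B ∣ * t ≤ sumℚ g
∣B∣*t≤sumℚ {zero} g [] t g≥0 g≥t = ≤-reflexive (*-zeroˡ t)
∣B∣*t≤sumℚ {suc n} g (outside ∷ B) t g≥0 g≥t =
  subst (_≤ sumℚ g) (+-identityˡ _)
    (+-mono-≤ (g≥0 zero) (∣B∣*t≤sumℚ (g ∘ suc) B t (g≥0 ∘ suc) (λ v → g≥t (suc v) ∘ there)))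
∣B∣*t≤sumℚ {suc n} g (inside ∷ B) t g≥0 g≥t =
  subst (_≤ sumℚ g) (≡-sym (ℕ→ℚ-suc-*-distrib ∣ B ∣ t))
    (+-mono-≤ (g≥t zero here) (∣B∣*t≤sumℚ (g ∘ suc) B t (g≥0 ∘ suc) (λ v → g≥t (suc v) ∘ there)))

module _ {n} {G : Graph n} {k} {x : Fin n → ℚ} {d f : Fin n → Fin n → ℚ}
         (F : Feasible G k x d f) where
  open Feasible F

  d≤offset+weight : ∀ u {a b} (p : Walk G a b) c →
                    d u a ≤ c + x a → d u b ≤ c + weight x p
  d≤offset+weight u (single a) c h =
    subst (d u a ≤_) (cong (λ z → c + z) (≡-sym (+-identityʳ (x a)))) h
  d≤offset+weight u (step {a} {v} a~v p) c h =
    subst (d u _ ≤_) (+-assoc c (x a) (weight x p))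
      (d≤offset+weight u p (c + x a) (≤-trans (metric u a v a~v) (+-monoˡ-≤ (x v) h)))

  d≤weight : ∀ {u v} (p : Walk G u v) → d u v ≤ weight x p
  d≤weight {u} p =
    subst (d u _ ≤_) (+-identityˡ (weight x p))
      (d≤offset+weight u p 0ℚ (≤-reflexive (trans (diag u) (≡-sym (+-identityˡ (x u))))))

  weight≤⇒1-r≤f : ∀ {u v} (p : Walk G u v) {r} → weight x p ≤ r → 1ℚ - r ≤ f u v
  weight≤⇒1-r≤f p p≤r = ≤-trans (+-monoʳ-≤ 1ℚ (neg-antimono-≤ (≤-trans (d≤weight p) p≤r))) (f-lb _ _)

  InBall⇒1-2ε≤f : ∀ {ε w v} → InBall G x ε w v → 1ℚ - ℕ→ℚ 2 * ε ≤ f w v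
  InBall⇒1-2ε≤f (_ , r , ((p , _ , p≡r) , _) , r≤2ε) = weight≤⇒1-r≤f p (≤-trans (≤-reflexive p≡r) r≤2ε)

lemma1 : ∀ (n : ℕ) (G : Graph n) (k : ℕ)
           (x : Fin n → ℚ) (d f : Fin n → Fin n → ℚ) →
           Optimal G k x d f →
           ∀ (ε : ℚ) → 0ℚ < ε → ε < ½ →
           ∀ (w : Fin n) → V′ x ε w →
           ∀ (B : Subset n) → (∀ v → (v ∈ B) ⇔ InBall G x ε w v) →
           ℕ→ℚ ∣ B ∣ * (1ℚ - ℕ→ℚ 2 * ε) ≤ ℕ→ℚ k
lemma1 n G k x d f opt ε _ _ w _ B B≡ball =
  ≤-trans (∣B∣*t≤sumℚ (f w) B _ (f-nn w) (λ v → InBall⇒1-2ε≤f F ∘ Equivalence.to (B≡ball v)))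
          (budget w)
  where
  F : Feasible G k x d f
  F = Optimal.feasible opt
  open Feasible F
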